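{- For all $n\in\mathbb{Z}^+$, the map $\lambda_n:\mathscr{L}_n\to\mathscr{O}_n$ is a bijection.
   Context: An ordered set partition of $[n]=\{1,\dots,n\}$ is a sequence $(B_1,\dots,B_k)$ of pairwise disjoint nonempty subsets (blocks) whose union is $[n]$. $\mathscr{L}_n$ is the set of ordered set partitions of $[n]$ with an even number of blocks. Define the cyclic predecessor relation on $[n]$ by $a\prec a+1$ for $1\le a<n$, and $n\prec 1$. An ordered set partition has no cyclical adjacencies if no block contains two elements $a,b$ with $a\prec b$. Equivalently, for $1\le j\le n-1$, $j$ and $j+1$ lie in different blocks, and $1$ and $n$ lie in different blocks. $\mathscr{O}_n$ is the set of ordered set partitions of $[n]$ with no cyclical adjacencies. The map $\lambda_n$ is defined as follows. Take $\mathbf{B}=(B_1,\dots,B_{2k})\in\mathscr{L}_n$ and start with $B_{2k+1}=\emptyset$. For each $i=1,\dots,2k$ and each maximal chain $j_1\prec j_2\prec\cdots\prec j_t$ ($t\ge 2$) of cyclically consecutive elements all lying in $B_i$, remove from $B_i$ the elements $j_2,j_4,\dots,j_{\gamma(t)}$ and put them into $B_{2k+1}$. Here $\gamma(t)=t$ if $t$ is even and $\gamma(t)=t-1$ if $t$ is odd. Then $\lambda_n(\mathbf{B})=(B_1,\dots,B_{2k},B_{2k+1})$, using the modified blocks, with the last block omitted if it is empty. -}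

module Defs where

open import Data.Nat using (ℕ; zero; suc; _*_)
open import Data.Bool using (Bool; true; false; not; _∧_; if_then_else_)
open import Data.Fin using (Fin; zero; suc; fromℕ; inject₁)
open import Data.Fin.Subset using (Subset; _∈_; _∪_; Nonempty; ⊥)
open import Data.Vec using (Vec; []; _∷_; lookup; tabulate)
open import Data.List using (List; []; _∷_; _++_; map; foldr; length)
open import Data.List.Relation.Unary.All using (All)
open import Data.List.Relation.Unary.Any using (Any)
open import Data.List.Relation.Unary.AllPairs using (AllPairs)
open import Data.Product using (_×_; ∃)
open import Relation.Binary.PropositionalEquality using (_≡_)
open import Relation.Nullary using (¬_)

-- Elements of [n] are represented by Fin n (element i+1 of [n] is the Fin value i).

cpred : ∀ {n} → Fin n → Fin n
cpred {suc m} zero    = fromℕ m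
cpred {suc m} (suc i) = inject₁ i

_≺_ : ∀ {n} → Fin n → Fin n → Set
a ≺ b = cpred b ≡ a

Block : ℕ → Set
Block n = Subset n

Disjoint : ∀ {n} → Block n → Block n → Set
Disjoint A B = ∀ x → x ∈ A → x ∈ B → Data.Empty.⊥
  where import Data.Empty

IsOSP : (n : ℕ) → List (Block n) → Set
IsOSP n bs = All Nonempty bs × AllPairs Disjoint bs × (∀ (x : Fin n) → Any (x ∈_) bs)

IsL : (n : ℕ) → List (Block n) → Set
IsL n bs = IsOSP n bs × ∃ λ k → length bs ≡ 2 * k

NoCycAdj : ∀ {n} → Block n → Set
NoCycAdj B = ∀ a b → a ∈ B → b ∈ B → a ≺ b → Data.Empty.⊥
  where import Data.Empty

IsO : (n : ℕ) → List (Block n) → Set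
IsO n bs = IsOSP n bs × All NoCycAdj bs

-- In a maximal chain j_1 ≺ j_2 ≺ … ≺ j_t inside a block B, the element
-- j_s is preceded (cyclically, inside B) by exactly s-1 consecutive
-- elements of B.  The removed elements j_2, j_4, …, j_γ(t) are exactly
-- the j_s with s even, i.e. the elements of B having an odd number of
-- consecutive cyclic predecessors in B.

isOdd : ℕ → Bool
isOdd zero    = false
isOdd (suc k) = not (isOdd k)

backRun : ∀ {n} → Subset n → ℕ → Fin n → ℕ
backRun B zero    j = 0
backRun B (suc f) j =
  if lookup B (cpred j) then suc (backRun B f (cpred j)) else 0

removedB : ∀ {n} → Subset n → Fin n → Bool
removedB {n} B j = lookup B j ∧ isOdd (backRun B n j)

keptPart : ∀ {n} → Subset n → Subset n
keptPart B = tabulate (λ j → lookup B j ∧ not (removedB B j))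

removedPart : ∀ {n} → Subset n → Subset n
removedPart B = tabulate (λ j → removedB B j)

allFalse : ∀ {n} → Vec Bool n → Bool
allFalse []       = true
allFalse (b ∷ v) = not b ∧ allFalse v

lastBlock : ∀ {n} → List (Subset n) → Subset n
lastBlock bs = foldr (λ B acc → removedPart B ∪ acc) ⊥ bs

lambdaMap : (n : ℕ) → List (Subset n) → List (Subset n)
lambdaMap n bs =
  map keptPart bs ++
    (if allFalse (lastBlock bs) then [] else (lastBlock bs ∷ []))

-- In a block B that misses some point, the elements removed by λ satisfy
--   x removed  ⇔  x ∈ B, cpred x ∈ B and cpred x not removed,
-- and this recurrence has a unique solution: follow cpred from x to a point
-- outside B.  Every block of a partition into an even number of blocks misses a
-- point of another block.  By the recurrence the kept part K of a block has no
-- cyclic adjacency, the removed elements form an adjacency-free block L, and the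
-- block is recovered as K ∪ {x ∈ L ∣ cpred x ∈ K}; the parity of the length
-- tells whether L is present, so λ is injective.  Conversely λ fixes
-- adjacency-free partitions with an even number of blocks, and
-- (D₁,…,D_{2k},L) is the image of the blocks D ∪ {x ∈ L ∣ cpred x ∈ D}, whose
-- removed parts are their intersections with L by uniqueness of the recurrence.
module Submission where

open import Defs
open import Data.Bool using (Bool; true; false; not; _∧_; if_then_else_)
open import Data.Empty using (⊥-elim)
open import Data.Fin using (Fin; zero; suc; fromℕ; inject₁; toℕ)
open import Data.Fin.Properties using (toℕ-injective; toℕ-inject₁; toℕ-fromℕ; toℕ<n)
open import Data.Fin.Subset using (Subset; _∈_; _∉_; _∪_; _∩_; _⊆_; Nonempty) renaming (⊥ to ∅)
open import Data.Fin.Subset.Properties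
  using (⊆-antisym; ∉⊥; ⊥⊆; x∈p∪q⁻; x∈p∩q⁺; x∈p∩q⁻; p⊆p∪q; q⊆p∪q)
open import Data.Nat using (ℕ; zero; suc; _+_; _*_; _∸_; _≤_; _<_; z≤n; s≤s; s≤s⁻¹)
open import Data.Nat.GeneralisedArithmetic using (iterate)
open import Data.Nat.Properties
  using (_≤?_; ≤-<-trans; <⇒≤; ≰⇒>; m≤n⇒m≤1+n; +-suc; +-monoˡ-≤; m∸n≤m; m∸[m∸n]≡n; m+[n∸m]≡n;
         *-suc; suc-injective; even≢odd; module ≤-Reasoning)
open import Data.Product using (_×_; _,_; proj₁; proj₂; ∃; ∃₂)
open import Data.Sum using (_⊎_; inj₁; inj₂; [_,_])
open import Data.List using (List; []; _∷_; _++_; _∷ʳ_; map; length; initLast; _∷ʳ′_)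
open import Data.List.Membership.Propositional using (find; lose) renaming (_∈_ to _∈ₗ_)
open import Data.List.Membership.Propositional.Properties using (∈-map⁺; ∈-map⁻)
open import Data.List.Relation.Unary.All as All using (All; []; _∷_)
open import Data.List.Relation.Unary.Any using (Any; here; there)
open import Data.List.Relation.Unary.AllPairs as AllPairs using (AllPairs; []; _∷_)
import Data.List.Relation.Unary.All.Properties as All
import Data.List.Relation.Unary.Any.Properties as Any
import Data.List.Relation.Unary.AllPairs.Properties as AllPairs
open import Data.List.Properties
  using (++-identityʳ; length-map; length-++-comm; ∷ʳ-injective; map-∘; map-id-local)
open import Data.Vec using ([]; _∷_; lookup; tabulate)
open import Data.Vec.Properties using (lookup∘tabulate; []=⇒lookup; lookup⇒[]=)
open import Function using (id; _⇔_; mk⇔; Equivalence)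
open import Relation.Binary.PropositionalEquality
  using (_≡_; _≢_; refl; sym; trans; cong; cong₂; subst; module ≡-Reasoning)
open import Relation.Nullary using (yes; no)

private
  variable
    n : ℕ
    B C K L : Subset n
    x : Fin n
    bs ds : List (Subset n)

-- Walking backwards along cpred

iterate-+ : ∀ {A : Set} (f : A → A) x m k → iterate f x (m + k) ≡ iterate f (iterate f x m) k
iterate-+ f x zero    k = refl
iterate-+ f x (suc m) k = iterate-+ f (f x) m k

toℕ-iterate-cpred : ∀ {n} d (x : Fin n) → d ≤ toℕ x → toℕ (iterate cpred x d) ≡ toℕ x ∸ d
toℕ-iterate-cpred zero    x       _         = refl
toℕ-iterate-cpred (suc d) (suc i) (s≤s d≤i) = begin
  toℕ (iterate cpred (inject₁ i) d)
    ≡⟨ toℕ-iterate-cpred d (inject₁ i) (subst (d ≤_) (sym (toℕ-inject₁ i)) d≤i) ⟩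
  toℕ (inject₁ i) ∸ d
    ≡⟨ cong (_∸ d) (toℕ-inject₁ i) ⟩
  toℕ i ∸ d
    ∎
  where open ≡-Reasoning

iterate-cpred-down : ∀ {n} (x y : Fin n) → toℕ y ≤ toℕ x → iterate cpred x (toℕ x ∸ toℕ y) ≡ y
iterate-cpred-down x y y≤x =
  toℕ-injective (trans (toℕ-iterate-cpred _ x (m∸n≤m (toℕ x) (toℕ y))) (m∸[m∸n]≡n y≤x))

cpred-reaches : ∀ {n} (x y : Fin n) → ∃ λ m → m < n × iterate cpred x m ≡ y
cpred-reaches {suc k} x y with toℕ y ≤? toℕ x
... | yes y≤x =
  toℕ x ∸ toℕ y , ≤-<-trans (m∸n≤m (toℕ x) (toℕ y)) (toℕ<n x) , iterate-cpred-down x y y≤x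
... | no  y≰x = toℕ x + suc e , s≤s bound , path  -- down to zero, wrap around to fromℕ k, down to y
  where
  e : ℕ
  e = k ∸ toℕ y
  y≤k : toℕ y ≤ k
  y≤k = s≤s⁻¹ (toℕ<n y)
  bound : toℕ x + suc e ≤ k
  bound = begin
    toℕ x + suc e   ≡⟨ +-suc (toℕ x) e ⟩
    suc (toℕ x) + e ≤⟨ +-monoˡ-≤ e (≰⇒> y≰x) ⟩
    toℕ y + e       ≡⟨ m+[n∸m]≡n y≤k ⟩
    k               ∎
    where open ≤-Reasoning
  path : iterate cpred x (toℕ x + suc e) ≡ y
  path = begin
    iterate cpred x (toℕ x + suc e)                 ≡⟨ iterate-+ cpred x (toℕ x) (suc e) ⟩
    iterate cpred (iterate cpred x (toℕ x)) (suc e)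
      ≡⟨ cong (λ z → iterate cpred z (suc e)) (iterate-cpred-down x zero z≤n) ⟩
    iterate cpred (fromℕ k) e
      ≡⟨ cong (λ m → iterate cpred (fromℕ k) (m ∸ toℕ y)) (sym (toℕ-fromℕ k)) ⟩
    iterate cpred (fromℕ k) (toℕ (fromℕ k) ∸ toℕ y)
      ≡⟨ iterate-cpred-down (fromℕ k) y (subst (toℕ y ≤_) (sym (toℕ-fromℕ k)) y≤k) ⟩
    y                                               ∎
    where open ≡-Reasoning

-- The removal recurrence

∧-true⁻ : ∀ {a b} → a ∧ b ≡ true → a ≡ true × b ≡ true
∧-true⁻ {true} {true} _ = refl , refl

not-true⁻ : ∀ {a} → not a ≡ true → a ≡ false
not-true⁻ {false} _ = refl

true≢false : true ≢ false
true≢false ()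

∈-tabulate⁺ : ∀ {f : Fin n → Bool} → f x ≡ true → x ∈ tabulate f
∈-tabulate⁺ {x = x} {f = f} fx = lookup⇒[]= x (tabulate f) (trans (lookup∘tabulate f x) fx)

∈-tabulate⁻ : ∀ {f : Fin n → Bool} → x ∈ tabulate f → f x ≡ true
∈-tabulate⁻ {x = x} {f = f} x∈ = trans (sym (lookup∘tabulate f x)) ([]=⇒lookup x∈)

∉-tabulate⁺ : ∀ {f : Fin n → Bool} → f x ≡ false → x ∉ tabulate f
∉-tabulate⁺ fx x∈ = true≢false (trans (sym (∈-tabulate⁻ x∈)) fx)

∉⇒lookup≡false : x ∉ B → lookup B x ≡ false
∉⇒lookup≡false {x = x} {B = B} x∉B with lookup B x in e
... | true  = ⊥-elim (x∉B (lookup⇒[]= x B e))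
... | false = refl

∉-tabulate⁻ : ∀ {f : Fin n → Bool} → x ∉ tabulate f → f x ≡ false
∉-tabulate⁻ {x = x} {f = f} x∉ = trans (sym (lookup∘tabulate f x)) (∉⇒lookup≡false x∉)

Proper : Subset n → Set
Proper B = ∃ λ y → y ∉ B

backRun-saturates : ∀ {n} (B : Subset n) k x → lookup B (iterate cpred x (suc k)) ≡ false →
                    ∀ {f} → k < f → backRun B f x ≡ backRun B (suc k) x
backRun-saturates B zero    x gap {suc f} _ rewrite gap = refl
backRun-saturates B (suc k) x gap {suc f} (s≤s k<f) =
  cong (λ r → if lookup B (cpred x) then suc r else 0) (backRun-saturates B k (cpred x) gap k<f)

-- Runs inside a proper block stop before the fuel n is exhausted.
backRun-fuel : ∀ {n} {B : Subset n} {x} → Proper B → x ∈ B → backRun B n x ≡ backRun B (suc n) x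
backRun-fuel {n} {B} {x} (y , y∉B) x∈B with cpred-reaches x y
... | zero  , _    , refl = ⊥-elim (y∉B x∈B)
... | suc k , 1+k<n , path =
  trans (backRun-saturates B k x gap (<⇒≤ 1+k<n))
        (sym (backRun-saturates B k x gap (m≤n⇒m≤1+n (<⇒≤ 1+k<n))))
  where
  gap : lookup B (iterate cpred x (suc k)) ≡ false
  gap = trans (cong (lookup B) path) (∉⇒lookup≡false y∉B)

removedB-recurrence : ∀ {n} {B : Subset n} → Proper B →
  ∀ x → removedB B x ≡ lookup B x ∧ (lookup B (cpred x) ∧ not (removedB B (cpred x)))
removedB-recurrence {n} {B} proper x with lookup B x in x∈B
... | false = refl
... | true  = begin
  isOdd (backRun B n x)              ≡⟨ cong isOdd (backRun-fuel proper (lookup⇒[]= x B x∈B)) ⟩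
  isOdd (backRun B (suc n) x)        ≡⟨ isOdd-run (lookup B (cpred x)) (backRun B n (cpred x)) ⟩
  lookup B (cpred x) ∧ not (removedB B (cpred x)) ∎
  where
  open ≡-Reasoning
  isOdd-run : ∀ b r → isOdd (if b then suc r else 0) ≡ b ∧ not (b ∧ isOdd r)
  isOdd-run true  r = refl
  isOdd-run false r = refl

RemovalRecurrence : Subset n → Subset n → Set
RemovalRecurrence B R = ∀ x → x ∈ R ⇔ (x ∈ B × cpred x ∈ B × cpred x ∉ R)

removedPart-recurrence : Proper B → RemovalRecurrence B (removedPart B)
removedPart-recurrence {B = B} proper x = mk⇔ to from
  where
  recurrence : removedB B x ≡ lookup B x ∧ (lookup B (cpred x) ∧ not (removedB B (cpred x)))
  recurrence = removedB-recurrence proper x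
  to : x ∈ removedPart B → x ∈ B × cpred x ∈ B × cpred x ∉ removedPart B
  to x∈R with ∧-true⁻ (trans (sym recurrence) (∈-tabulate⁻ x∈R))
  ... | x∈B , rest with ∧-true⁻ rest
  ... | cx∈B , cx∉R = lookup⇒[]= x B x∈B , lookup⇒[]= (cpred x) B cx∈B ,
                      ∉-tabulate⁺ (not-true⁻ cx∉R)
  from : x ∈ B × cpred x ∈ B × cpred x ∉ removedPart B → x ∈ removedPart B
  from (x∈B , cx∈B , cx∉R) =
    ∈-tabulate⁺ (trans recurrence (all-hold ([]=⇒lookup x∈B) ([]=⇒lookup cx∈B) (∉-tabulate⁻ cx∉R)))
    where
    all-hold : ∀ {a b c} → a ≡ true → b ≡ true → c ≡ false → a ∧ (b ∧ not c) ≡ true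
    all-hold refl refl refl = refl

recurrence-unique : ∀ {n} {B R S : Subset n} → Proper B →
                    RemovalRecurrence B R → RemovalRecurrence B S → R ≡ S
recurrence-unique {B = B} (y , y∉B) recR recS = ⊆-antisym (transfer recR recS) (transfer recS recR)
  where
  along : ∀ m {R S} → RemovalRecurrence B R → RemovalRecurrence B S →
          ∀ x → iterate cpred x m ≡ y → x ∈ R → x ∈ S
  along zero    recR recS x refl x∈R = ⊥-elim (y∉B (proj₁ (Equivalence.to (recR x) x∈R)))
  along (suc m) recR recS x path x∈R with Equivalence.to (recR x) x∈R
  ... | x∈B , cx∈B , cx∉R =
    Equivalence.from (recS x) (x∈B , cx∈B , λ cx∈S → cx∉R (along m recS recR (cpred x) path cx∈S))
  transfer : ∀ {R S} → RemovalRecurrence B R → RemovalRecurrence B S → R ⊆ S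
  transfer recR recS {x} x∈R =
    let m , _ , path = cpred-reaches x y in along m recR recS x path x∈R

removedPart⊆ : x ∈ removedPart B → x ∈ B
removedPart⊆ x∈R = lookup⇒[]= _ _ (proj₁ (∧-true⁻ (∈-tabulate⁻ x∈R)))

∈-keptPart⁻ : x ∈ keptPart B → x ∈ B × x ∉ removedPart B
∈-keptPart⁻ x∈K with ∧-true⁻ (∈-tabulate⁻ x∈K)
... | x∈B , x∉R = lookup⇒[]= _ _ x∈B , ∉-tabulate⁺ (not-true⁻ x∉R)

∈-keptPart⁺ : x ∈ B → x ∉ removedPart B → x ∈ keptPart B
∈-keptPart⁺ x∈B x∉R = ∈-tabulate⁺ (cong₂ _∧_ ([]=⇒lookup x∈B) (cong not (∉-tabulate⁻ x∉R)))

keptPart⊎removedPart : x ∈ B → x ∈ keptPart B ⊎ x ∈ removedPart B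
keptPart⊎removedPart {x = x} {B = B} x∈B with removedB B x in e
... | true  = inj₂ (∈-tabulate⁺ e)
... | false = inj₁ (∈-keptPart⁺ x∈B (∉-tabulate⁺ e))

keptPart⊆ : keptPart B ⊆ B
keptPart⊆ x∈K = proj₁ (∈-keptPart⁻ x∈K)

removedPart⇒pred-keptPart : Proper B → x ∈ removedPart B → cpred x ∈ keptPart B
removedPart⇒pred-keptPart {x = x} proper x∈R =
  let _ , cx∈B , cx∉R = Equivalence.to (removedPart-recurrence proper x) x∈R
  in ∈-keptPart⁺ cx∈B cx∉R

pred-keptPart⇒removedPart : Proper B → x ∈ B → cpred x ∈ keptPart B → x ∈ removedPart B
pred-keptPart⇒removedPart {x = x} proper x∈B cx∈K =
  let cx∈B , cx∉R = ∈-keptPart⁻ cx∈K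
  in Equivalence.from (removedPart-recurrence proper x) (x∈B , cx∈B , cx∉R)

keptPart-NoCycAdj : Proper B → NoCycAdj (keptPart B)
keptPart-NoCycAdj proper a b a∈K b∈K refl =
  let b∈B , b∉R = ∈-keptPart⁻ b∈K in b∉R (pred-keptPart⇒removedPart proper b∈B a∈K)

keptPart-Nonempty : Proper B → Nonempty B → Nonempty (keptPart B)
keptPart-Nonempty proper (x , x∈B) with keptPart⊎removedPart x∈B
... | inj₁ x∈K = x , x∈K
... | inj₂ x∈R = cpred x , removedPart⇒pred-keptPart proper x∈R

-- Partitions and the last block

∈-lastBlock⁺ : B ∈ₗ bs → x ∈ removedPart B → x ∈ lastBlock bs
∈-lastBlock⁺ {bs = B ∷ bs} (here refl) x∈R = p⊆p∪q (lastBlock bs) x∈R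
∈-lastBlock⁺ {bs = C ∷ bs} (there B∈) x∈R = q⊆p∪q (removedPart C) (lastBlock bs) (∈-lastBlock⁺ B∈ x∈R)

∈-lastBlock⁻ : x ∈ lastBlock bs → ∃ λ B → B ∈ₗ bs × x ∈ removedPart B
∈-lastBlock⁻ {bs = []}     x∈L = ⊥-elim (∉⊥ x∈L)
∈-lastBlock⁻ {bs = B ∷ bs} x∈L with x∈p∪q⁻ (removedPart B) (lastBlock bs) x∈L
... | inj₁ x∈R  = B , here refl , x∈R
... | inj₂ x∈L′ = let C , C∈ , x∈R = ∈-lastBlock⁻ x∈L′ in C , there C∈ , x∈R

sameBlock : AllPairs Disjoint bs → B ∈ₗ bs → C ∈ₗ bs → x ∈ B → x ∈ C → B ≡ C
sameBlock (_ ∷ _)     (here refl) (here refl) _   _   = refl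
sameBlock (disj ∷ _)  (here refl) (there C∈)  x∈B x∈C = ⊥-elim (All.lookup disj C∈ _ x∈B x∈C)
sameBlock (disj ∷ _)  (there B∈)  (here refl) x∈B x∈C = ⊥-elim (All.lookup disj B∈ _ x∈C x∈B)
sameBlock (_ ∷ disjs) (there B∈)  (there C∈)  x∈B x∈C = sameBlock disjs B∈ C∈ x∈B x∈C

pointOutside : All Nonempty bs → AllPairs Disjoint bs → (∃ λ k → length bs ≡ 2 * k) → B ∈ₗ bs →
               ∃₂ λ y C → C ∈ₗ bs × y ∈ C × y ∉ B
pointOutside {bs = _ ∷ []} _ _ (k , len) (here refl) = ⊥-elim (even≢odd k 0 (sym len))
pointOutside {bs = _ ∷ C ∷ _} (_ ∷ (y , y∈C) ∷ _) ((disj ∷ _) ∷ _) _ (here refl) =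
  y , C , there (here refl) , y∈C , λ y∈B → disj y y∈B y∈C
pointOutside {bs = C ∷ _} ((y , y∈C) ∷ _) (disj ∷ _) _ (there B∈) =
  y , C , here refl , y∈C , λ y∈B → All.lookup disj B∈ y y∈C y∈B

-- lambdaMap n bs is, by definition, map keptPart bs ++ optionalBlock (lastBlock bs).
optionalBlock : Subset n → List (Subset n)
optionalBlock L = if allFalse L then [] else L ∷ []

allFalse⇒≡∅ : ∀ (L : Subset n) → allFalse L ≡ true → L ≡ ∅
allFalse⇒≡∅ []          _ = refl
allFalse⇒≡∅ (false ∷ L) e = cong (false ∷_) (allFalse⇒≡∅ L e)

allFalse≡false⇒Nonempty : ∀ (L : Subset n) → allFalse L ≡ false → Nonempty L
allFalse≡false⇒Nonempty (true ∷ L)  _ = zero , lookup⇒[]= zero (true ∷ L) refl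
allFalse≡false⇒Nonempty (false ∷ L) e =
  let x , x∈L = allFalse≡false⇒Nonempty L e in suc x , lookup⇒[]= (suc x) (false ∷ L) ([]=⇒lookup x∈L)

optionalBlock-view : ∀ (L : Subset n) →
  (L ≡ ∅ × optionalBlock L ≡ []) ⊎ (Nonempty L × optionalBlock L ≡ L ∷ [])
optionalBlock-view L with allFalse L in e
... | true  = inj₁ (allFalse⇒≡∅ L e , refl)
... | false = inj₂ (allFalse≡false⇒Nonempty L e , refl)

IsO-++-optionalBlock : ∀ {Ks : List (Subset n)} →
  All Nonempty Ks → AllPairs Disjoint Ks → All (λ K → Disjoint K L) Ks →
  (∀ x → Any (x ∈_) Ks ⊎ x ∈ L) → All NoCycAdj Ks → NoCycAdj L →
  IsO n (Ks ++ optionalBlock L)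
IsO-++-optionalBlock {L = L} {Ks} nonempty disjoint disjoint-L cover noAdj noAdj-L
  with optionalBlock-view L
... | inj₁ (refl , none) rewrite none | ++-identityʳ Ks =
  (nonempty , disjoint , λ x → [ id , (λ x∈∅ → ⊥-elim (∉⊥ x∈∅)) ] (cover x)) , noAdj
... | inj₂ (nonempty-L , one) rewrite one =
  ( All.++⁺ nonempty (nonempty-L ∷ [])
  , AllPairs.++⁺ disjoint ([] ∷ []) (All.map (_∷ []) disjoint-L)
  , λ x → [ Any.++⁺ˡ , (λ x∈L → Any.++⁺ʳ Ks (here x∈L)) ] (cover x) )
  , All.++⁺ noAdj (noAdj-L ∷ [])

restoreBlock : Subset n → Subset n → Subset n
restoreBlock L K = K ∪ (L ∩ tabulate (λ x → lookup K (cpred x)))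

∈-restoreBlock⁻ : x ∈ restoreBlock L K → x ∈ K ⊎ (x ∈ L × cpred x ∈ K)
∈-restoreBlock⁻ {L = L} {K = K} x∈ with x∈p∪q⁻ K _ x∈
... | inj₁ x∈K  = inj₁ x∈K
... | inj₂ x∈L∩ = let x∈L , x∈S = x∈p∩q⁻ L _ x∈L∩ in inj₂ (x∈L , lookup⇒[]= _ K (∈-tabulate⁻ x∈S))

K⊆restoreBlock : K ⊆ restoreBlock L K
K⊆restoreBlock {L = L} = p⊆p∪q _

∈-restoreBlock⁺ : x ∈ L → cpred x ∈ K → x ∈ restoreBlock L K
∈-restoreBlock⁺ {K = K} x∈L cx∈K = q⊆p∪q K _ (x∈p∩q⁺ (x∈L , ∈-tabulate⁺ ([]=⇒lookup cx∈K)))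

module EvenPartition {bs : List (Subset n)} (bs∈𝓛 : IsL n bs) where

  private
    nonempty : All Nonempty bs
    nonempty = proj₁ (proj₁ bs∈𝓛)
    disjoint : AllPairs Disjoint bs
    disjoint = proj₁ (proj₂ (proj₁ bs∈𝓛))
    cover : ∀ x → Any (x ∈_) bs
    cover = proj₂ (proj₂ (proj₁ bs∈𝓛))

  proper : B ∈ₗ bs → Proper B
  proper B∈ = let y , _ , _ , _ , y∉B = pointOutside nonempty disjoint (proj₂ bs∈𝓛) B∈ in y , y∉B

  removedPart-lastBlock : B ∈ₗ bs → x ∈ B → x ∈ lastBlock bs → x ∈ removedPart B
  removedPart-lastBlock {x = x} B∈ x∈B x∈L =
    let C , C∈ , x∈RC = ∈-lastBlock⁻ x∈L
    in subst (λ D → x ∈ removedPart D) (sameBlock disjoint C∈ B∈ (removedPart⊆ x∈RC) x∈B) x∈RC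

  keptPart-Disjoint-lastBlock : B ∈ₗ bs → Disjoint (keptPart B) (lastBlock bs)
  keptPart-Disjoint-lastBlock B∈ x x∈K x∈L =
    let x∈B , x∉R = ∈-keptPart⁻ x∈K in x∉R (removedPart-lastBlock B∈ x∈B x∈L)

  lastBlock-NoCycAdj : NoCycAdj (lastBlock bs)
  lastBlock-NoCycAdj a b a∈L b∈L refl =
    let C , C∈ , b∈RC = ∈-lastBlock⁻ b∈L
    in keptPart-Disjoint-lastBlock C∈ a (removedPart⇒pred-keptPart (proper C∈) b∈RC) a∈L

  keptParts-or-lastBlock : ∀ x → Any (x ∈_) (map keptPart bs) ⊎ x ∈ lastBlock bs
  keptParts-or-lastBlock x with find (cover x)
  ... | B , B∈ , x∈B with keptPart⊎removedPart x∈B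
  ...   | inj₁ x∈K = inj₁ (lose (∈-map⁺ keptPart B∈) x∈K)
  ...   | inj₂ x∈R = inj₂ (∈-lastBlock⁺ B∈ x∈R)

  lambdaMap-IsO : IsO n (lambdaMap n bs)
  lambdaMap-IsO = IsO-++-optionalBlock
    (All.map⁺ (All.tabulate λ B∈ → keptPart-Nonempty (proper B∈) (All.lookup nonempty B∈)))
    (AllPairs.map⁺ (AllPairs.map (λ disj x x∈K x∈K′ → disj x (keptPart⊆ x∈K) (keptPart⊆ x∈K′)) disjoint))
    (All.map⁺ (All.tabulate keptPart-Disjoint-lastBlock))
    keptParts-or-lastBlock
    (All.map⁺ (All.tabulate λ B∈ → keptPart-NoCycAdj (proper B∈)))
    lastBlock-NoCycAdj

  restoreBlock-keptPart : B ∈ₗ bs → restoreBlock (lastBlock bs) (keptPart B) ≡ B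
  restoreBlock-keptPart {B = B} B∈ = ⊆-antisym restored⊆B B⊆restored
    where
    restored⊆B : restoreBlock (lastBlock bs) (keptPart B) ⊆ B
    restored⊆B {x} x∈ with ∈-restoreBlock⁻ x∈
    ... | inj₁ x∈K = keptPart⊆ x∈K
    ... | inj₂ (x∈L , cx∈K) =
      let C , C∈ , x∈RC = ∈-lastBlock⁻ x∈L
          cx∈C = keptPart⊆ (removedPart⇒pred-keptPart (proper C∈) x∈RC)
      in subst (x ∈_) (sameBlock disjoint C∈ B∈ cx∈C (keptPart⊆ cx∈K)) (removedPart⊆ x∈RC)
    B⊆restored : B ⊆ restoreBlock (lastBlock bs) (keptPart B)
    B⊆restored x∈B with keptPart⊎removedPart x∈B
    ... | inj₁ x∈K = K⊆restoreBlock x∈K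
    ... | inj₂ x∈R = ∈-restoreBlock⁺ (∈-lastBlock⁺ B∈ x∈R) (removedPart⇒pred-keptPart (proper B∈) x∈R)

  restoreBlocks-keptParts : map (restoreBlock (lastBlock bs)) (map keptPart bs) ≡ bs
  restoreBlocks-keptParts = trans (sym (map-∘ bs)) (map-id-local (All.tabulate restoreBlock-keptPart))

even≢length-∷ʳ : ∀ {A : Set} {xs ys : List A} {y} →
  (∃ λ k → length xs ≡ 2 * k) → (∃ λ k → length ys ≡ 2 * k) → xs ≢ ys ∷ʳ y
even≢length-∷ʳ {xs = xs} {ys} {y} (k , len) (k′ , len′) xs≡ = even≢odd k k′ (begin
  2 * k                 ≡⟨ sym len ⟩
  length xs             ≡⟨ cong length xs≡ ⟩
  length (ys ++ y ∷ []) ≡⟨ length-++-comm ys (y ∷ []) ⟩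
  suc (length ys)       ≡⟨ cong suc len′ ⟩
  suc (2 * k′)          ∎)
  where open ≡-Reasoning

++-optionalBlock-injective : ∀ {Ks Ks′ : List (Subset n)} {L L′} →
  (∃ λ k → length Ks ≡ 2 * k) → (∃ λ k → length Ks′ ≡ 2 * k) →
  Ks ++ optionalBlock L ≡ Ks′ ++ optionalBlock L′ → Ks ≡ Ks′ × L ≡ L′
++-optionalBlock-injective {Ks = Ks} {Ks′} {L} {L′} even even′ eq
  with optionalBlock L | optionalBlock-view L | optionalBlock L′ | optionalBlock-view L′
... | _ | inj₁ (refl , refl) | _ | inj₁ (refl , refl) =
  trans (sym (++-identityʳ Ks)) (trans eq (++-identityʳ Ks′)) , refl
... | _ | inj₁ (_ , refl) | _ | inj₂ (_ , refl) =
  ⊥-elim (even≢length-∷ʳ even even′ (trans (sym (++-identityʳ Ks)) eq))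
... | _ | inj₂ (_ , refl) | _ | inj₁ (_ , refl) =
  ⊥-elim (even≢length-∷ʳ even′ even (trans (sym (++-identityʳ Ks′)) (sym eq)))
... | _ | inj₂ (_ , refl) | _ | inj₂ (_ , refl) = ∷ʳ-injective Ks Ks′ eq

lambdaMap-injective : ∀ (bs cs : List (Subset n)) → IsL n bs → IsL n cs →
                      lambdaMap n bs ≡ lambdaMap n cs → bs ≡ cs
lambdaMap-injective bs cs bs∈𝓛@(_ , k , len) cs∈𝓛@(_ , k′ , len′) eq
  with ++-optionalBlock-injective (k , trans (length-map keptPart bs) len)
                                  (k′ , trans (length-map keptPart cs) len′) eq
... | keptParts≡ , lastBlocks≡ = begin
  bs
    ≡⟨ sym (EvenPartition.restoreBlocks-keptParts bs∈𝓛) ⟩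
  map (restoreBlock (lastBlock bs)) (map keptPart bs)
    ≡⟨ cong₂ (λ L Ks → map (restoreBlock L) Ks) lastBlocks≡ keptParts≡ ⟩
  map (restoreBlock (lastBlock cs)) (map keptPart cs)
    ≡⟨ EvenPartition.restoreBlocks-keptParts cs∈𝓛 ⟩
  cs
    ∎
  where open ≡-Reasoning

-- Surjectivity

NoCycAdj⇒removedB≡false : ∀ {n} {B : Subset n} → NoCycAdj B → ∀ x → removedB B x ≡ false
NoCycAdj⇒removedB≡false {suc _} {B} noAdj x with lookup B x in x∈B
... | false = refl
... | true with lookup B (cpred x) in cx∈B
...   | false = refl
...   | true  = ⊥-elim (noAdj (cpred x) x (lookup⇒[]= _ B cx∈B) (lookup⇒[]= x B x∈B) refl)

NoCycAdj⇒keptPart≡ : NoCycAdj B → keptPart B ≡ B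
NoCycAdj⇒keptPart≡ noAdj =
  ⊆-antisym keptPart⊆ λ x∈B → ∈-keptPart⁺ x∈B (∉-tabulate⁺ (NoCycAdj⇒removedB≡false noAdj _))

NoCycAdj⇒lastBlock≡∅ : All NoCycAdj bs → lastBlock bs ≡ ∅
NoCycAdj⇒lastBlock≡∅ {bs = bs} noAdj = ⊆-antisym empty ⊥⊆
  where
  empty : lastBlock bs ⊆ ∅
  empty x∈L = let C , C∈ , x∈R = ∈-lastBlock⁻ x∈L
              in ⊥-elim (∉-tabulate⁺ (NoCycAdj⇒removedB≡false (All.lookup noAdj C∈) _) x∈R)

optionalBlock-∅ : optionalBlock (∅ {n}) ≡ []
optionalBlock-∅ {n} with optionalBlock-view (∅ {n})
... | inj₁ (_ , none)          = none
... | inj₂ ((_ , x∈∅) , _) = ⊥-elim (∉⊥ x∈∅)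

optionalBlock-Nonempty : Nonempty L → optionalBlock L ≡ L ∷ []
optionalBlock-Nonempty {L = L} (x , x∈L) with optionalBlock-view L
... | inj₁ (refl , _) = ⊥-elim (∉⊥ x∈L)
... | inj₂ (_ , one)  = one

lambdaMap-fixes-NoCycAdj : All NoCycAdj bs → lambdaMap n bs ≡ bs
lambdaMap-fixes-NoCycAdj {bs = bs} noAdj = begin
  map keptPart bs ++ optionalBlock (lastBlock bs)
    ≡⟨ cong₂ _++_ (map-id-local (All.map NoCycAdj⇒keptPart≡ noAdj)) (cong optionalBlock (NoCycAdj⇒lastBlock≡∅ noAdj)) ⟩
  bs ++ optionalBlock ∅
    ≡⟨ cong (bs ++_) optionalBlock-∅ ⟩
  bs ++ []
    ≡⟨ ++-identityʳ bs ⟩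
  bs
    ∎
  where open ≡-Reasoning

restoreBlock-Disjoint : Disjoint K C → Disjoint K L → Disjoint C L →
                        Disjoint (restoreBlock L K) (restoreBlock L C)
restoreBlock-Disjoint K#C K#L C#L x x∈ x∈′ with ∈-restoreBlock⁻ x∈ | ∈-restoreBlock⁻ x∈′
... | inj₁ x∈K        | inj₁ x∈C        = K#C x x∈K x∈C
... | inj₁ x∈K        | inj₂ (x∈L , _)  = K#L x x∈K x∈L
... | inj₂ (x∈L , _)  | inj₁ x∈C        = C#L x x∈C x∈L
... | inj₂ (_ , cx∈K) | inj₂ (_ , cx∈C) = K#C (cpred x) cx∈K cx∈C

restoreBlocks-Disjoint : AllPairs Disjoint ds → All (λ K → Disjoint K L) ds →
                         AllPairs Disjoint (map (restoreBlock L) ds)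
restoreBlocks-Disjoint []                []            = []
restoreBlocks-Disjoint (K#ds ∷ disjoint) (K#L ∷ ds#L) =
  All.map⁺ (All.zipWith (λ (K#C , C#L) → restoreBlock-Disjoint K#C K#L C#L) (K#ds , ds#L))
  ∷ restoreBlocks-Disjoint disjoint ds#L

AllPairs-∷ʳ⁻ : ∀ {A : Set} {R : A → A → Set} (xs : List A) {y} →
               AllPairs R (xs ∷ʳ y) → AllPairs R xs × All (λ x → R x y) xs
AllPairs-∷ʳ⁻ []       _          = [] , []
AllPairs-∷ʳ⁻ (x ∷ xs) (Rx ∷ Rxs) =
  let Rx-xs , Rxy = All.∷ʳ⁻ Rx
      Rxs′ , Rxsy = AllPairs-∷ʳ⁻ xs Rxs
  in Rx-xs ∷ Rxs′ , Rxy ∷ Rxsy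

module OddPartition {ds : List (Subset n)} {L : Subset n} (ds∷ʳL∈𝓞 : IsO n (ds ∷ʳ L))
                    (ds-even : ∃ λ k → length ds ≡ 2 * k) where

  private
    nonempty : All Nonempty ds × Nonempty L
    nonempty = All.∷ʳ⁻ (proj₁ (proj₁ ds∷ʳL∈𝓞))
    disjoint : AllPairs Disjoint ds × All (λ K → Disjoint K L) ds
    disjoint = AllPairs-∷ʳ⁻ ds (proj₁ (proj₂ (proj₁ ds∷ʳL∈𝓞)))
    noAdj : All NoCycAdj ds × NoCycAdj L
    noAdj = All.∷ʳ⁻ (proj₂ ds∷ʳL∈𝓞)

    cover : ∀ x → Any (x ∈_) ds ⊎ x ∈ L
    cover x with Any.++⁻ ds (proj₂ (proj₂ (proj₁ ds∷ʳL∈𝓞)) x)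
    ... | inj₁ x∈ds = inj₁ x∈ds
    ... | inj₂ x∈L  = inj₂ (Any.singleton⁻ x∈L)

    K#L : K ∈ₗ ds → Disjoint K L
    K#L = All.lookup (proj₂ disjoint)

  pred-∈-ds : x ∈ L → ∃ λ K → K ∈ₗ ds × cpred x ∈ K
  pred-∈-ds {x = x} x∈L with cover (cpred x)
  ... | inj₁ cx∈ds = find cx∈ds
  ... | inj₂ cx∈L  = ⊥-elim (proj₂ noAdj (cpred x) x cx∈L x∈L refl)

  proper : K ∈ₗ ds → Proper (restoreBlock L K)
  proper K∈ with pointOutside (proj₁ nonempty) (proj₁ disjoint) ds-even K∈
  ... | y , C , C∈ , y∈C , y∉K =
    y , λ y∈B → [ y∉K , (λ (y∈L , _) → K#L C∈ y y∈C y∈L) ] (∈-restoreBlock⁻ y∈B)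

  removedPart-restoreBlock : K ∈ₗ ds → removedPart (restoreBlock L K) ≡ restoreBlock L K ∩ L
  removedPart-restoreBlock {K = K} K∈ =
    recurrence-unique (proper K∈) (removedPart-recurrence (proper K∈)) λ x → mk⇔ to from
    where
    B′ : Subset n
    B′ = restoreBlock L K
    to : x ∈ B′ ∩ L → x ∈ B′ × cpred x ∈ B′ × cpred x ∉ B′ ∩ L
    to {x} x∈B′∩L with x∈p∩q⁻ B′ L x∈B′∩L
    ... | x∈B′ , x∈L with ∈-restoreBlock⁻ x∈B′
    ...   | inj₁ x∈K        = ⊥-elim (K#L K∈ x x∈K x∈L)
    ...   | inj₂ (_ , cx∈K) =
      x∈B′ , K⊆restoreBlock cx∈K , λ cx∈B′∩L → K#L K∈ (cpred x) cx∈K (proj₂ (x∈p∩q⁻ B′ L cx∈B′∩L))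
    from : x ∈ B′ × cpred x ∈ B′ × cpred x ∉ B′ ∩ L → x ∈ B′ ∩ L
    from {x} (x∈B′ , cx∈B′ , cx∉B′∩L) with ∈-restoreBlock⁻ cx∈B′ | ∈-restoreBlock⁻ x∈B′
    ... | inj₂ (cx∈L , _) | _               = ⊥-elim (cx∉B′∩L (x∈p∩q⁺ (cx∈B′ , cx∈L)))
    ... | inj₁ cx∈K       | inj₁ x∈K        = ⊥-elim (All.lookup (proj₁ noAdj) K∈ (cpred x) x cx∈K x∈K refl)
    ... | inj₁ _          | inj₂ (x∈L , _)  = x∈p∩q⁺ (x∈B′ , x∈L)

  removedPart-restoreBlock⁺ : K ∈ₗ ds → x ∈ restoreBlock L K → x ∈ L → x ∈ removedPart (restoreBlock L K)
  removedPart-restoreBlock⁺ {x = x} K∈ x∈B x∈L =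
    subst (x ∈_) (sym (removedPart-restoreBlock K∈)) (x∈p∩q⁺ (x∈B , x∈L))

  removedPart-restoreBlock⊆L : K ∈ₗ ds → x ∈ removedPart (restoreBlock L K) → x ∈ L
  removedPart-restoreBlock⊆L {K = K} {x = x} K∈ x∈R =
    proj₂ (x∈p∩q⁻ (restoreBlock L K) L (subst (x ∈_) (removedPart-restoreBlock K∈) x∈R))

  keptPart-restoreBlock : K ∈ₗ ds → keptPart (restoreBlock L K) ≡ K
  keptPart-restoreBlock {K = K} K∈ = ⊆-antisym kept⊆K K⊆kept
    where
    kept⊆K : keptPart (restoreBlock L K) ⊆ K
    kept⊆K x∈kept with ∈-keptPart⁻ x∈kept
    ... | x∈B , x∉R with ∈-restoreBlock⁻ x∈B
    ...   | inj₁ x∈K       = x∈K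
    ...   | inj₂ (x∈L , _) = ⊥-elim (x∉R (removedPart-restoreBlock⁺ K∈ x∈B x∈L))
    K⊆kept : K ⊆ keptPart (restoreBlock L K)
    K⊆kept {x} x∈K =
      ∈-keptPart⁺ (K⊆restoreBlock x∈K) λ x∈R → K#L K∈ x x∈K (removedPart-restoreBlock⊆L K∈ x∈R)

  preimage : List (Subset n)
  preimage = map (restoreBlock L) ds

  lastBlock-preimage : lastBlock preimage ≡ L
  lastBlock-preimage = ⊆-antisym lastBlock⊆L L⊆lastBlock
    where
    lastBlock⊆L : lastBlock preimage ⊆ L
    lastBlock⊆L {x} x∈ with ∈-lastBlock⁻ x∈
    ... | B , B∈ , x∈R with ∈-map⁻ (restoreBlock L) B∈
    ...   | K , K∈ , refl = removedPart-restoreBlock⊆L K∈ x∈R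
    L⊆lastBlock : L ⊆ lastBlock preimage
    L⊆lastBlock x∈L with pred-∈-ds x∈L
    ... | K , K∈ , cx∈K =
      ∈-lastBlock⁺ (∈-map⁺ (restoreBlock L) K∈) (removedPart-restoreBlock⁺ K∈ (∈-restoreBlock⁺ x∈L cx∈K) x∈L)

  preimage-IsL : IsL n preimage
  preimage-IsL =
    ( All.map⁺ (All.tabulate λ K∈ →
        let x , x∈K = All.lookup (proj₁ nonempty) K∈ in x , K⊆restoreBlock x∈K)
    , restoreBlocks-Disjoint (proj₁ disjoint) (proj₂ disjoint)
    , preimage-cover )
    , proj₁ ds-even , trans (length-map (restoreBlock L) ds) (proj₂ ds-even)
    where
    preimage-cover : ∀ x → Any (x ∈_) preimage
    preimage-cover x with cover x
    ... | inj₁ x∈ds =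
      let K , K∈ , x∈K = find x∈ds in lose (∈-map⁺ (restoreBlock L) K∈) (K⊆restoreBlock x∈K)
    ... | inj₂ x∈L  =
      let K , K∈ , cx∈K = pred-∈-ds x∈L in lose (∈-map⁺ (restoreBlock L) K∈) (∈-restoreBlock⁺ x∈L cx∈K)

  lambdaMap-preimage : lambdaMap n preimage ≡ ds ∷ʳ L
  lambdaMap-preimage = begin
    map keptPart preimage ++ optionalBlock (lastBlock preimage)
      ≡⟨ cong₂ _++_ keptParts-preimage (cong optionalBlock lastBlock-preimage) ⟩
    ds ++ optionalBlock L
      ≡⟨ cong (ds ++_) (optionalBlock-Nonempty (proj₂ nonempty)) ⟩
    ds ∷ʳ L
      ∎
    where
    open ≡-Reasoning
    keptParts-preimage : map keptPart preimage ≡ ds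
    keptParts-preimage = trans (sym (map-∘ ds)) (map-id-local (All.tabulate keptPart-restoreBlock))

parity : ∀ m → (∃ λ k → m ≡ 2 * k) ⊎ (∃ λ k → m ≡ suc (2 * k))
parity zero = inj₁ (0 , refl)
parity (suc m) with parity m
... | inj₁ (k , m≡) = inj₂ (k , cong suc m≡)
... | inj₂ (k , m≡) = inj₁ (suc k , trans (cong suc m≡) (sym (*-suc 2 k)))

lambdaMap-surjective : ∀ (cs : List (Subset n)) → IsO n cs → ∃ λ bs → IsL n bs × lambdaMap n bs ≡ cs
lambdaMap-surjective cs cs∈𝓞 with parity (length cs) | initLast cs
... | inj₁ even | _ = cs , (proj₁ cs∈𝓞 , even) , lambdaMap-fixes-NoCycAdj (proj₂ cs∈𝓞)
... | inj₂ (_ , ()) | []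
... | inj₂ (k , len) | ds ∷ʳ′ L = preimage , preimage-IsL , lambdaMap-preimage
  where
  open OddPartition cs∈𝓞 (k , suc-injective (trans (sym (length-++-comm ds (L ∷ []))) len))

theorem3p13 : ∀ (n : ℕ) → 1 ≤ n →
      (∀ (bs : List (Subset n)) → IsL n bs → IsO n (lambdaMap n bs))
    × (∀ (bs cs : List (Subset n)) → IsL n bs → IsL n cs →
         lambdaMap n bs ≡ lambdaMap n cs → bs ≡ cs)
    × (∀ (cs : List (Subset n)) → IsO n cs →
         ∃ λ (bs : List (Subset n)) → IsL n bs × lambdaMap n bs ≡ cs)
theorem3p13 n _ = (λ _ → EvenPartition.lambdaMap-IsO) , lambdaMap-injective , lambdaMap-surjective
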